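{- For all integers $R\ge 1$ and $\delta\ge 1$, every finite hypergraph in which every hyperedge has at most $R$ vertices and every vertex has degree at least $\delta$ satisfies $\mathsf{p}'(H)\ge\lfloor\delta/\ln(\mathrm{e}R\delta^2)\rfloor$.
   Context: A hypergraph $H=(V,\mathcal{E})$ has finite vertex set $V$ and a finite multiset $\mathcal{E}$ of subsets of $V$. The degree of a vertex is the number of hyperedges containing it. A set cover is a subfamily of $\mathcal{E}$ with union $V$; $\mathsf{p}'(H)$ is the maximum $k$ such that $\mathcal{E}$ can be partitioned into $k$ set covers. -}

module Defs where

open import Data.Nat using (ℕ; zero; suc; _+_; _*_; _∸_; _^_; _≤_; _!)
open import Data.Nat.Properties using (_!≢0)
open import Data.Fin using (Fin)
open import Data.Fin.Subset using (Subset; _∈_; ∣_∣)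
open import Data.Fin.Subset.Properties using (_∈?_)
open import Data.List using (length; filter; allFin)
open import Data.Product using (Σ; ∃; _×_)
open import Data.Integer using (+_)
open import Relation.Binary.PropositionalEquality using (_≡_)
import Data.Rational as ℚ
open ℚ using (ℚ)

-- A finite hypergraph with vertex set Fin n and a multiset of m hyperedges,
-- given as an indexed family (so repeated hyperedges are allowed).
record Hypergraph : Set where
  field
    n     : ℕ
    m     : ℕ
    edge  : Fin m → Subset n

open Hypergraph public

degree : (H : Hypergraph) → Fin (n H) → ℕ
degree H v = length (filter (λ e → v ∈? edge H e) (allFin (m H)))

PartitionIntoCovers : (H : Hypergraph) → ℕ → Set
PartitionIntoCovers H k =
  Σ (Fin (m H) → Fin k) λ c →
    (i : Fin k) (v : Fin (n H)) → ∃ λ e → (c e ≡ i) × (v ∈ edge H e)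

-- p'(H) ≥ t : there is k ≥ t such that the hyperedges can be partitioned
-- into k set covers (p'(H) is the maximum such k).
p′-atLeast : Hypergraph → ℕ → Set
p′-atLeast H t = ∃ λ k → t ≤ k × PartitionIntoCovers H k

expPartial : ℕ → ℕ → ℚ
expPartial x zero    = ℚ.1ℚ
expPartial x (suc j) = expPartial x j ℚ.+ (+ (x ^ suc j) ℚ./ (suc j !)) {{suc j !≢0}}

-- N ≤ e^x  for natural numbers N, x.  Since the partial sums increase to e^x
-- and e^x is irrational for x ≥ 1 (and equals 1 for x = 0), this holds iff
-- some partial sum is ≥ N.
≤exp : ℕ → ℕ → Set
≤exp N x = ∃ λ j → (ℚ._/_ (+ N) 1) ℚ.≤ expPartial x j

-- t ≤ δ / ln(e R δ²), for naturals t, R ≥ 1, δ ≥ 1.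
-- Equivalent (as ln(eRδ²) = 1 + ln(Rδ²) > 0) to  t · (1 + ln(Rδ²)) ≤ δ,
-- i.e.  t ≤ δ  and  (R δ²)^t ≤ e^(δ - t).
-- Hence t ≤ ⌊δ / ln(e R δ²)⌋ iff  BelowBound R δ t.
BelowBound : ℕ → ℕ → ℕ → Set
BelowBound R δ t = t ≤ δ × ≤exp ((R * (δ * δ)) ^ t) (δ ∸ t)

module Submission where

-- Colour the hyperedges uniformly at random with t ≥ 2 colours and fix δ hyperedges at
-- each vertex v; call v bad if some colour is missing among them.  This has probability
-- at most p = t (1 - 1/t)^δ and depends only on the colours of those δ hyperedges, so it
-- is independent of the bad events of all vertices whose chosen hyperedges avoid them,
-- which leaves at most D = Rδ dependent vertices.  The symmetric local lemma in the form
-- 4pD ≤ 1 gives a colouring without bad vertices, i.e. a partition into t set covers;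
-- probabilities are replaced by numbers of colourings throughout.  The condition 4pD ≤ 1
-- follows from t ln(eRδ²) ≤ δ since e ≤ (1 + 1/u)^(u+1) for u = t - 1, which holds
-- because (1 - x)^(-N) = Σ C(N+i-1, i) x^i dominates the exponential series termwise.

open import Defs
open import Data.Nat using (ℕ; _≤_)
open import Data.Fin using (Fin)
open import Data.Fin.Subset using (∣_∣)

open import Data.Nat
open import Data.Nat.Properties
open import Data.Nat.Tactic.RingSolver using (solve-∀)
open import Data.Bool using (Bool; true; false; _∧_; _∨_; not; if_then_else_)
open import Data.Bool.Properties using (∧-identityʳ; not-involutive; not-¬; not-injective)
open import Data.Fin using (Fin; zero; suc) renaming (_≟_ to _≟ᶠ_)
open import Data.Fin.Subset using (Subset; _∈_; ∣_∣)
open import Data.Fin.Subset.Properties using (_∈?_)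
open import Data.Vec using ([]; _∷_; lookup)
open import Data.Vec.Properties using (lookup⇒[]=)
open import Data.Vec.Functional using (foldr) renaming (_∷_ to _◂_)
open import Data.List using (length; filter; tabulate)
open import Data.Product using (∃; _,_; _×_; proj₁; proj₂)
open import Data.Empty using (⊥-elim)
import Data.Integer as ℤ
import Data.Integer.Properties as ℤ
import Data.Rational as ℚ
import Data.Rational.Properties as ℚ
open import Data.Rational.Unnormalised as ℚᵘ using (ℚᵘ; mkℚᵘ; ↥_; ↧_; ↧ₙ_; *≤*)
import Data.Rational.Unnormalised.Properties as ℚᵘ
open import Function using (_∘_)
open import Relation.Nullary using (does; yes; Dec)
open import Relation.Nullary.Decidable using (dec-true)
open import Relation.Unary using (Pred; Decidable)
open import Relation.Binary.PropositionalEquality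
open import Algebra.Properties.Semiring.Sum +-*-semiring
  using (sum; sum-syntax; ∑-distrib-+; ∑-comm; *-distribˡ-sum; *-distribʳ-sum)
open import Algebra.Properties.CommutativeSemigroup *-commutativeSemigroup
  using (interchange; x∙yz≈y∙xz; x∙yz≈y∙zx; xy∙z≈y∙xz; xy∙z≈yz∙x)

sum-cong : ∀ {k} {f g : Fin k → ℕ} → (∀ i → f i ≡ g i) → sum f ≡ sum g
sum-cong {zero}  f≗g = refl
sum-cong {suc k} f≗g = cong₂ _+_ (f≗g zero) (sum-cong (f≗g ∘ suc))

sum-mono-≤ : ∀ {k} {f g : Fin k → ℕ} → (∀ i → f i ≤ g i) → sum f ≤ sum g
sum-mono-≤ {zero}  f≤g = z≤n
sum-mono-≤ {suc k} f≤g = +-mono-≤ (f≤g zero) (sum-mono-≤ (f≤g ∘ suc))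

sum-const : ∀ k c → ∑[ i < k ] c ≡ k * c
sum-const zero    c = refl
sum-const (suc k) c = cong (c +_) (sum-const k c)

term≤sum : ∀ {k} (f : Fin k → ℕ) i → f i ≤ sum f
term≤sum f zero    = m≤m+n _ _
term≤sum f (suc i) = ≤-trans (term≤sum (f ∘ suc) i) (m≤n+m _ _)

sum>0⇒term>0 : ∀ {k} (f : Fin k → ℕ) → 0 < sum f → ∃ λ i → 0 < f i
sum>0⇒term>0 {suc k} f sum>0 with f zero in eq
... | suc _ = zero , subst (0 <_) (sym eq) z<s
... | zero with sum>0⇒term>0 (f ∘ suc) sum>0
...   | i , fi>0 = suc i , fi>0

sum-*-balanced : ∀ {k} (F G : Fin k → ℕ) → (∀ a b → G a ≡ G b) →
                 k * ∑[ a < k ] (F a * G a) ≡ sum F * sum G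
sum-*-balanced {k} F G balanced = begin
  k * ∑[ a < k ] (F a * G a)     ≡⟨ *-distribˡ-sum k (λ a → F a * G a) ⟩
  ∑[ a < k ] (k * (F a * G a))   ≡⟨ sum-cong (λ a → x∙yz≈y∙xz k (F a) (G a)) ⟩
  ∑[ a < k ] (F a * (k * G a))   ≡⟨ sum-cong (λ a → cong (F a *_) (k*Ga≡sumG a)) ⟩
  ∑[ a < k ] (F a * sum G)       ≡⟨ *-distribʳ-sum (sum G) F ⟨
  sum F * sum G                  ∎
  where
  open ≡-Reasoning
  k*Ga≡sumG : ∀ a → k * G a ≡ sum G
  k*Ga≡sumG a = trans (sym (sum-const k (G a))) (sum-cong (balanced a))

prod : ∀ {k} → (Fin k → ℕ) → ℕ
prod = foldr _*_ 1

prod-cong : ∀ {k} {f g : Fin k → ℕ} → (∀ i → f i ≡ g i) → prod f ≡ prod g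
prod-cong {zero}  f≗g = refl
prod-cong {suc k} f≗g = cong₂ _*_ (f≗g zero) (prod-cong (f≗g ∘ suc))

𝟙 : Bool → ℕ
𝟙 true  = 1
𝟙 false = 0

𝟙-∧ : ∀ a b → 𝟙 (a ∧ b) ≡ 𝟙 a * 𝟙 b
𝟙-∧ true  b = sym (+-identityʳ _)
𝟙-∧ false b = refl

𝟙-∨ : ∀ a b → 𝟙 (a ∨ b) ≤ 𝟙 a + 𝟙 b
𝟙-∨ true  b = s≤s z≤n
𝟙-∨ false b = ≤-refl

𝟙>0⇒ : ∀ {b} → 0 < 𝟙 b → b ≡ true
𝟙>0⇒ {true} _ = refl

nand≡false⇒ : ∀ a b → not (a ∧ b) ≡ false → a ≡ true × b ≡ true
nand≡false⇒ true true _ = refl , refl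

∧≡false⇒ : ∀ {a b} → a ≡ true → b ∧ a ≡ false → b ≡ false
∧≡false⇒ {b = false} _    _ = refl
∧≡false⇒ {b = true}  refl ()

𝟙-∧-monoʳ : ∀ a {b b′} → (b ≡ true → b′ ≡ true) → 𝟙 (a ∧ b) ≤ 𝟙 (a ∧ b′)
𝟙-∧-monoʳ false         _    = z≤n
𝟙-∧-monoʳ true {false}  _    = z≤n
𝟙-∧-monoʳ true {true}   b⇒b′ rewrite b⇒b′ refl = ≤-refl

allᵇ anyᵇ : ∀ {k} → (Fin k → Bool) → Bool
allᵇ = foldr _∧_ true
anyᵇ = foldr _∨_ false

allᵇ-intro : ∀ {k} (p : Fin k → Bool) → (∀ i → p i ≡ true) → allᵇ p ≡ true
allᵇ-intro {zero}  p all = refl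
allᵇ-intro {suc k} p all rewrite all zero = allᵇ-intro (p ∘ suc) (all ∘ suc)

allᵇ-elim : ∀ {k} (p : Fin k → Bool) → allᵇ p ≡ true → ∀ i → p i ≡ true
allᵇ-elim {suc k} p all i with p zero in eq
allᵇ-elim {suc k} p all zero    | true = eq
allᵇ-elim {suc k} p all (suc i) | true = allᵇ-elim (p ∘ suc) all i

allᵇ-false : ∀ {k} (p : Fin k → Bool) → allᵇ p ≡ false → ∃ λ i → p i ≡ false
allᵇ-false {suc k} p ¬all with p zero in eq
... | false = zero , eq
... | true with allᵇ-false (p ∘ suc) ¬all
...   | i , pi≡false = suc i , pi≡false

anyᵇ-elim : ∀ {k} (p : Fin k → Bool) → anyᵇ p ≡ true → ∃ λ i → p i ≡ true
anyᵇ-elim {suc k} p any with p zero in eq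
... | true = zero , eq
... | false with anyᵇ-elim (p ∘ suc) any
...   | i , pi≡true = suc i , pi≡true

anyᵇ-false : ∀ {k} (p : Fin k → Bool) → anyᵇ p ≡ false → ∀ i → p i ≡ false
anyᵇ-false {suc k} p ¬any i with p zero in eq
anyᵇ-false {suc k} p ¬any zero    | false = eq
anyᵇ-false {suc k} p ¬any (suc i) | false = anyᵇ-false (p ∘ suc) ¬any i

allᵇ-cong : ∀ {k} {p q : Fin k → Bool} → (∀ i → p i ≡ q i) → allᵇ p ≡ allᵇ q
allᵇ-cong {zero}  p≗q = refl
allᵇ-cong {suc k} p≗q = cong₂ _∧_ (p≗q zero) (allᵇ-cong (p≗q ∘ suc))

anyᵇ-cong : ∀ {k} {p q : Fin k → Bool} → (∀ i → p i ≡ q i) → anyᵇ p ≡ anyᵇ q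
anyᵇ-cong {zero}  p≗q = refl
anyᵇ-cong {suc k} p≗q = cong₂ _∨_ (p≗q zero) (anyᵇ-cong (p≗q ∘ suc))

𝟙-allᵇ : ∀ {k} (p : Fin k → Bool) → 𝟙 (allᵇ p) ≡ prod (𝟙 ∘ p)
𝟙-allᵇ {zero}  p = refl
𝟙-allᵇ {suc k} p = trans (𝟙-∧ (p zero) _) (cong (𝟙 (p zero) *_) (𝟙-allᵇ (p ∘ suc)))

𝟙-anyᵇ : ∀ {k} (p : Fin k → Bool) → 𝟙 (anyᵇ p) ≤ sum (𝟙 ∘ p)
𝟙-anyᵇ {zero}  p = z≤n
𝟙-anyᵇ {suc k} p = ≤-trans (𝟙-∨ (p zero) _) (+-monoʳ-≤ (𝟙 (p zero)) (𝟙-anyᵇ (p ∘ suc)))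

size : ∀ {n} → (Fin n → Bool) → ℕ
size S = sum (𝟙 ∘ S)

_⊆_ : ∀ {n} → (Fin n → Bool) → (Fin n → Bool) → Set
T ⊆ S = ∀ w → T w ≡ true → S w ≡ true

_∖_ : ∀ {n} → (Fin n → Bool) → (Fin n → Bool) → Fin n → Bool
(S ∖ T) w = S w ∧ not (T w)

∖-true⇒ : ∀ {n} {S T : Fin n → Bool} w → (S ∖ T) w ≡ true → S w ≡ true × T w ≡ false
∖-true⇒ {S = S} {T} w w∈S∖T with S w | T w
... | true | false = refl , refl

∖-⊆ : ∀ {n} (S T : Fin n → Bool) → (S ∖ T) ⊆ S
∖-⊆ S T w = proj₁ ∘ ∖-true⇒ {S = S} {T} w

size-∖ : ∀ {n} {S T : Fin n → Bool} → T ⊆ S → size S ≡ size T + size (S ∖ T)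
size-∖ {S = S} {T} T⊆S = trans (sum-cong split) (∑-distrib-+ (𝟙 ∘ T) (𝟙 ∘ (S ∖ T)))
  where
  split : ∀ w → 𝟙 (S w) ≡ 𝟙 (T w) + 𝟙 ((S ∖ T) w)
  split w with T w in eq
  ... | true  rewrite T⊆S w eq = refl
  ... | false rewrite ∧-identityʳ (S w) = refl

size-mono : ∀ {n} {S T : Fin n → Bool} → T ⊆ S → size T ≤ size S
size-mono {S = S} {T} T⊆S = ≤-trans (m≤m+n (size T) _) (≤-reflexive (sym (size-∖ T⊆S)))

size-< : ∀ {n} {S T : Fin n → Bool} → T ⊆ S → ∀ j → (S ∖ T) j ≡ true → size T < size S
size-< {S = S} {T} T⊆S j j∈S∖T = begin-strict
  size T                  <⟨ m<m+n (size T) (≤-trans (≤-reflexive (cong 𝟙 (sym j∈S∖T))) (term≤sum _ j)) ⟩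
  size T + size (S ∖ T)   ≡⟨ size-∖ T⊆S ⟨
  size S                  ∎
  where open ≤-Reasoning

single : ∀ {n} → Fin n → Fin n → Bool
single j w = does (w ≟ᶠ j)

size-single : ∀ {n} (j : Fin n) → size (single j) ≡ 1
size-single {suc n} zero    = cong suc (trans (sum-const n 0) (*-zeroʳ n))
size-single {suc n} (suc j) = size-single j

∖∖-⊆ : ∀ {n} (S U : Fin n → Bool) → (S ∖ (S ∖ U)) ⊆ U
∖∖-⊆ S U w with S w | U w
... | true | true = λ _ → refl

size-∁-single : ∀ {k} (j : Fin (suc k)) → size (not ∘ single j) ≡ k
size-∁-single {k}     zero    = trans (sum-const k 1) (*-identityʳ k)
size-∁-single {suc k} (suc j) = cong suc (size-∁-single j)

-- Counting colourings

module Colourings (t : ℕ) where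

  Colouring : ℕ → Set
  Colouring m = Fin m → Fin t

  ∑ᶜ : ∀ {m} → (Colouring m → ℕ) → ℕ
  ∑ᶜ {zero}  f = f (λ ())
  ∑ᶜ {suc m} f = ∑[ a < t ] ∑ᶜ (λ c → f (a ◂ c))

  ∑ᶜ-cong : ∀ {m} {f g : Colouring m → ℕ} → (∀ c → f c ≡ g c) → ∑ᶜ f ≡ ∑ᶜ g
  ∑ᶜ-cong {zero}  f≗g = f≗g _
  ∑ᶜ-cong {suc m} f≗g = sum-cong (λ a → ∑ᶜ-cong (λ c → f≗g (a ◂ c)))

  ∑ᶜ-mono-≤ : ∀ {m} {f g : Colouring m → ℕ} → (∀ c → f c ≤ g c) → ∑ᶜ f ≤ ∑ᶜ g
  ∑ᶜ-mono-≤ {zero}  f≤g = f≤g _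
  ∑ᶜ-mono-≤ {suc m} f≤g = sum-mono-≤ (λ a → ∑ᶜ-mono-≤ (λ c → f≤g (a ◂ c)))

  ∑ᶜ-distrib-+ : ∀ {m} (f g : Colouring m → ℕ) → ∑ᶜ (λ c → f c + g c) ≡ ∑ᶜ f + ∑ᶜ g
  ∑ᶜ-distrib-+ {zero}  f g = refl
  ∑ᶜ-distrib-+ {suc m} f g =
    trans (sum-cong (λ a → ∑ᶜ-distrib-+ (λ c → f (a ◂ c)) (λ c → g (a ◂ c))))
          (∑-distrib-+ (λ a → ∑ᶜ (λ c → f (a ◂ c))) (λ a → ∑ᶜ (λ c → g (a ◂ c))))

  *-distribˡ-∑ᶜ : ∀ {m} k (f : Colouring m → ℕ) → k * ∑ᶜ f ≡ ∑ᶜ (λ c → k * f c)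
  *-distribˡ-∑ᶜ {zero}  k f = refl
  *-distribˡ-∑ᶜ {suc m} k f =
    trans (*-distribˡ-sum k (λ a → ∑ᶜ (λ c → f (a ◂ c)))) (sum-cong (λ a → *-distribˡ-∑ᶜ k (λ c → f (a ◂ c))))

  ∑ᶜ-comm-sum : ∀ {m k} (f : Fin k → Colouring m → ℕ) →
                ∑ᶜ (λ c → ∑[ i < k ] f i c) ≡ ∑[ i < k ] ∑ᶜ (f i)
  ∑ᶜ-comm-sum {zero}  f = refl
  ∑ᶜ-comm-sum {suc m} f =
    trans (sum-cong (λ a → ∑ᶜ-comm-sum (λ i c → f i (a ◂ c))))
          (∑-comm (λ a i → ∑ᶜ (λ c → f i (a ◂ c))))

  ∑ᶜ-const : ∀ m k → ∑ᶜ {m} (λ _ → k) ≡ t ^ m * k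
  ∑ᶜ-const zero    k = sym (+-identityʳ k)
  ∑ᶜ-const (suc m) k = begin
    ∑[ a < t ] ∑ᶜ {m} (λ _ → k)   ≡⟨ sum-cong {t} (λ _ → ∑ᶜ-const m k) ⟩
    ∑[ a < t ] (t ^ m * k)        ≡⟨ sum-const t (t ^ m * k) ⟩
    t * (t ^ m * k)               ≡⟨ *-assoc t (t ^ m) k ⟨
    t ^ suc m * k                 ∎
    where open ≡-Reasoning

  ∑ᶜ-prod : ∀ {m} (w : Fin m → Fin t → ℕ) →
            ∑ᶜ (λ c → prod (λ e → w e (c e))) ≡ prod (λ e → sum (w e))
  ∑ᶜ-prod {zero}  w = refl
  ∑ᶜ-prod {suc m} w = begin
    ∑[ a < t ] ∑ᶜ (λ c → w zero a * prod (λ e → w (suc e) (c e)))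
      ≡⟨ sum-cong (λ a → *-distribˡ-∑ᶜ (w zero a) (λ c → prod (λ e → w (suc e) (c e)))) ⟨
    ∑[ a < t ] (w zero a * ∑ᶜ (λ c → prod (λ e → w (suc e) (c e))))
      ≡⟨ sum-cong (λ a → cong (w zero a *_) (∑ᶜ-prod (w ∘ suc))) ⟩
    ∑[ a < t ] (w zero a * prod (λ e → sum (w (suc e))))
      ≡⟨ *-distribʳ-sum (prod (λ e → sum (w (suc e)))) (w zero) ⟨
    sum (w zero) * prod (λ e → sum (w (suc e)))
      ∎
    where open ≡-Reasoning

  ∑ᶜ>0⇒ : ∀ {m} (f : Colouring m → ℕ) → 0 < ∑ᶜ f → ∃ λ c → 0 < f c
  ∑ᶜ>0⇒ {zero}  f ∑ᶜf>0 = _ , ∑ᶜf>0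
  ∑ᶜ>0⇒ {suc m} f ∑ᶜf>0 with sum>0⇒term>0 _ ∑ᶜf>0
  ... | a , >0 with ∑ᶜ>0⇒ _ >0
  ...   | c , fc>0 = a ◂ c , fc>0

  DependsOn : ∀ {m} → (Fin m → Bool) → (Colouring m → ℕ) → Set
  DependsOn L f = ∀ c c′ → (∀ e → L e ≡ true → c e ≡ c′ e) → f c ≡ f c′

  dependsOn-tail : ∀ {m} {L : Fin (suc m) → Bool} {f : Colouring (suc m) → ℕ} →
                   DependsOn L f → ∀ a → DependsOn (L ∘ suc) (λ c → f (a ◂ c))
  dependsOn-tail df a c c′ agree = df (a ◂ c) (a ◂ c′) λ where
    zero    _   → refl
    (suc e) Lse → agree e Lse

  dependsOn-head : ∀ {m} {L : Fin (suc m) → Bool} {f : Colouring (suc m) → ℕ} →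
                   L zero ≡ false → DependsOn L f → ∀ a b c → f (a ◂ c) ≡ f (b ◂ c)
  dependsOn-head L₀≡false df a b c = df (a ◂ c) (b ◂ c) λ where
    zero    L₀≡true → ⊥-elim (not-¬ L₀≡false L₀≡true)
    (suc e) _       → refl

  dependsOn-not-not : ∀ {m} {L : Fin m → Bool} {f : Colouring m → ℕ} →
                      DependsOn L f → DependsOn (not ∘ not ∘ L) f
  dependsOn-not-not {L = L} df c c′ agree = df c c′ (λ e Le → agree e (trans (not-involutive (L e)) Le))

  ∑ᶜ-independent : ∀ {m} (L : Fin m → Bool) {f g : Colouring m → ℕ} →
                   DependsOn L f → DependsOn (not ∘ L) g →
                   t ^ m * ∑ᶜ (λ c → f c * g c) ≡ ∑ᶜ f * ∑ᶜ g
  ∑ᶜ-independent-head : ∀ {m} (L : Fin (suc m) → Bool) {f g : Colouring (suc m) → ℕ} →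
                        not (L zero) ≡ false → DependsOn L f → DependsOn (not ∘ L) g →
                        t ^ suc m * ∑ᶜ (λ c → f c * g c) ≡ ∑ᶜ f * ∑ᶜ g

  ∑ᶜ-independent {zero} L df dg = *-identityˡ _
  ∑ᶜ-independent {suc m} L {f} {g} df dg with L zero in L₀
  ... | true  = ∑ᶜ-independent-head L (cong not L₀) df dg
  -- The first coordinate lies outside L: exchange the roles of f and g.
  ... | false = begin
    t ^ suc m * ∑ᶜ (λ c → f c * g c) ≡⟨ cong (t ^ suc m *_) (∑ᶜ-cong (λ c → *-comm (f c) (g c))) ⟩
    t ^ suc m * ∑ᶜ (λ c → g c * f c) ≡⟨ ∑ᶜ-independent-head (not ∘ L) (cong (not ∘ not) L₀) dg (dependsOn-not-not df) ⟩
    ∑ᶜ g * ∑ᶜ f                      ≡⟨ *-comm (∑ᶜ g) (∑ᶜ f) ⟩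
    ∑ᶜ f * ∑ᶜ g                      ∎
    where open ≡-Reasoning

  ∑ᶜ-independent-head {m} L {f} {g} ¬L₀≡false df dg = begin
    t * t ^ m * ∑[ a < t ] ∑ᶜ (λ c → fᵃ a c * gᵃ a c)   ≡⟨ *-assoc t (t ^ m) _ ⟩
    t * (t ^ m * ∑[ a < t ] ∑ᶜ (λ c → fᵃ a c * gᵃ a c)) ≡⟨ cong (t *_) (*-distribˡ-sum (t ^ m) (λ a → ∑ᶜ (λ c → fᵃ a c * gᵃ a c))) ⟩
    t * ∑[ a < t ] (t ^ m * ∑ᶜ (λ c → fᵃ a c * gᵃ a c)) ≡⟨ cong (t *_) (sum-cong (λ a → ∑ᶜ-independent (L ∘ suc) (dependsOn-tail df a) (dependsOn-tail dg a))) ⟩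
    t * ∑[ a < t ] (∑ᶜ (fᵃ a) * ∑ᶜ (gᵃ a))              ≡⟨ sum-*-balanced (λ a → ∑ᶜ (fᵃ a)) (λ a → ∑ᶜ (gᵃ a)) gᵃ-balanced ⟩
    ∑[ a < t ] ∑ᶜ (fᵃ a) * ∑[ a < t ] ∑ᶜ (gᵃ a)         ∎
    where
    open ≡-Reasoning
    fᵃ gᵃ : Fin t → Colouring m → ℕ
    fᵃ a c = f (a ◂ c)
    gᵃ a c = g (a ◂ c)
    gᵃ-balanced : ∀ a b → ∑ᶜ (gᵃ a) ≡ ∑ᶜ (gᵃ b)
    gᵃ-balanced a b = ∑ᶜ-cong (dependsOn-head ¬L₀≡false dg a b)

-- The symmetric local lemma, by counting

module LocalLemma {t m n : ℕ} .{{_ : NonZero t}} (A : Fin n → Colourings.Colouring t m → Bool)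
  (Γ : Fin n → Fin n → Bool) (D : ℕ) .{{_ : NonZero D}} where

  open Colourings t

  avoids : (Fin n → Bool) → Colouring m → Bool
  avoids S c = allᵇ (λ w → not (S w ∧ A w c))

  #avoiding : (Fin n → Bool) → ℕ
  #avoiding S = ∑ᶜ (𝟙 ∘ avoids S)

  #A : Fin n → ℕ
  #A i = ∑ᶜ (𝟙 ∘ A i)

  #A-avoiding : Fin n → (Fin n → Bool) → ℕ
  #A-avoiding i S = ∑ᶜ (λ c → 𝟙 (A i c ∧ avoids S c))

  avoids-antitone : ∀ {S T} c → T ⊆ S → avoids S c ≡ true → avoids T c ≡ true
  avoids-antitone {S} {T} c T⊆S S-avoided = allᵇ-intro _ λ w → shrink (T w) (T⊆S w) (allᵇ-elim _ S-avoided w)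
    where
    shrink : ∀ {s a} b → (b ≡ true → s ≡ true) → not (s ∧ a) ≡ true → not (b ∧ a) ≡ true
    shrink false _   _     = refl
    shrink true  b⇒s ¬s∧a rewrite b⇒s refl = ¬s∧a

  #A-avoiding-antitone : ∀ {S T} i → T ⊆ S → #A-avoiding i S ≤ #A-avoiding i T
  #A-avoiding-antitone {S} {T} i T⊆S = ∑ᶜ-mono-≤ λ c → 𝟙-∧-monoʳ (A i c) (avoids-antitone c T⊆S)

  #avoiding-union-bound : ∀ {S T} → T ⊆ S →
    #avoiding T ≤ #avoiding S + ∑[ j < n ] (𝟙 ((S ∖ T) j) * #A-avoiding j T)
  #avoiding-union-bound {S} {T} T⊆S = begin
    ∑ᶜ (𝟙 ∘ avoids T)
      ≤⟨ ∑ᶜ-mono-≤ pointwise ⟩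
    ∑ᶜ (λ c → 𝟙 (avoids S c) + ∑[ j < n ] (𝟙 ((S ∖ T) j) * 𝟙 (A j c ∧ avoids T c)))
      ≡⟨ ∑ᶜ-distrib-+ (𝟙 ∘ avoids S) _ ⟩
    #avoiding S + ∑ᶜ (λ c → ∑[ j < n ] (𝟙 ((S ∖ T) j) * 𝟙 (A j c ∧ avoids T c)))
      ≡⟨ cong (#avoiding S +_) (∑ᶜ-comm-sum (λ j c → 𝟙 ((S ∖ T) j) * 𝟙 (A j c ∧ avoids T c))) ⟩
    #avoiding S + ∑[ j < n ] ∑ᶜ (λ c → 𝟙 ((S ∖ T) j) * 𝟙 (A j c ∧ avoids T c))
      ≡⟨ cong (#avoiding S +_) (sum-cong (λ j → *-distribˡ-∑ᶜ (𝟙 ((S ∖ T) j)) (λ c → 𝟙 (A j c ∧ avoids T c)))) ⟨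
    #avoiding S + ∑[ j < n ] (𝟙 ((S ∖ T) j) * #A-avoiding j T)
      ∎
    where
    open ≤-Reasoning
    pointwise : ∀ c → 𝟙 (avoids T c) ≤ 𝟙 (avoids S c) + ∑[ j < n ] (𝟙 ((S ∖ T) j) * 𝟙 (A j c ∧ avoids T c))
    pointwise c with avoids T c in T-avoided
    ... | false = z≤n
    ... | true with avoids S c in S-avoided
    ...   | true  = s≤s z≤n
    ...   | false with allᵇ-false _ S-avoided
    ...     | w , ¬avoided with nand≡false⇒ (S w) (A w c) ¬avoided
    ...       | Sw , Aw = ≤-trans (≤-reflexive (sym term-w≡1)) (term≤sum _ w)
      where
      term-w≡1 : 𝟙 ((S ∖ T) w) * 𝟙 (A w c ∧ true) ≡ 1
      term-w≡1 rewrite Sw | ∧≡false⇒ Aw (not-injective (allᵇ-elim _ T-avoided w)) | Aw = refl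

  #avoiding-halving : ∀ {S T} → T ⊆ S → size (S ∖ T) ≤ D →
    (∀ j → (S ∖ T) j ≡ true → 2 * D * #A-avoiding j T ≤ #avoiding T) →
    #avoiding T ≤ 2 * #avoiding S
  #avoiding-halving {S} {T} T⊆S S∖T-small bounded =
    *-cancelˡ-≤ D (+-cancelʳ-≤ (D * fT) (D * fT) (D * (2 * fS)) (begin
      D * fT + D * fT          ≡⟨ double (D * fT) ⟨
      2 * (D * fT)             ≤⟨ *-monoʳ-≤ 2 (*-monoʳ-≤ D (#avoiding-union-bound T⊆S)) ⟩
      2 * (D * (fS + Σbad))    ≡⟨ regroup D fS Σbad ⟩
      D * (2 * fS) + 2 * D * Σbad  ≤⟨ +-monoʳ-≤ (D * (2 * fS)) weighted ⟩
      D * (2 * fS) + D * fT    ∎))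
    where
    open ≤-Reasoning
    fS fT Σbad : ℕ
    fS = #avoiding S
    fT = #avoiding T
    Σbad = ∑[ j < n ] (𝟙 ((S ∖ T) j) * #A-avoiding j T)
    double : ∀ x → 2 * x ≡ x + x
    double = solve-∀
    regroup : ∀ D x y → 2 * (D * (x + y)) ≡ D * (2 * x) + 2 * D * y
    regroup = solve-∀
    pointwise : ∀ j → 2 * D * (𝟙 ((S ∖ T) j) * #A-avoiding j T) ≤ 𝟙 ((S ∖ T) j) * fT
    pointwise j with (S ∖ T) j in j∈S∖T
    ... | false = ≤-reflexive (*-zeroʳ (2 * D))
    ... | true  rewrite *-identityˡ (#A-avoiding j T) | *-identityˡ fT = bounded j j∈S∖T
    weighted : 2 * D * Σbad ≤ D * fT
    weighted = begin
      2 * D * Σbad                                   ≡⟨ *-distribˡ-sum (2 * D) (λ j → 𝟙 ((S ∖ T) j) * #A-avoiding j T) ⟩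
      ∑[ j < n ] (2 * D * (𝟙 ((S ∖ T) j) * #A-avoiding j T)) ≤⟨ sum-mono-≤ pointwise ⟩
      ∑[ j < n ] (𝟙 ((S ∖ T) j) * fT)               ≡⟨ *-distribʳ-sum fT (𝟙 ∘ (S ∖ T)) ⟨
      size (S ∖ T) * fT                              ≤⟨ *-monoˡ-≤ fT S∖T-small ⟩
      D * fT                                         ∎

  module _ (A-independent : ∀ i S → t ^ m * #A-avoiding i (S ∖ Γ i) ≤ #A i * #avoiding (S ∖ Γ i))
           (Γ-small : ∀ i → size (Γ i) ≤ D)
           (A-rare : ∀ i → 4 * D * #A i ≤ t ^ m) where

    -- In probabilistic terms: P(A i | no event of S occurs) ≤ 1 / 2D.
    #A-avoiding-bound : ∀ k S → size S < k → ∀ i → 2 * D * #A-avoiding i S ≤ #avoiding S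
    #A-avoiding-bound (suc k) S |S|<1+k i = *-cancelˡ-≤ (t ^ m) {{m^n≢0 t m}} (begin
      t ^ m * (2 * D * #A-avoiding i S)   ≤⟨ *-monoʳ-≤ (t ^ m) (*-monoʳ-≤ (2 * D) (#A-avoiding-antitone i T⊆S)) ⟩
      t ^ m * (2 * D * #A-avoiding i T)   ≡⟨ x∙yz≈y∙xz (t ^ m) (2 * D) (#A-avoiding i T) ⟩
      2 * D * (t ^ m * #A-avoiding i T)   ≤⟨ *-monoʳ-≤ (2 * D) (A-independent i S) ⟩
      2 * D * (#A i * #avoiding T)        ≤⟨ *-monoʳ-≤ (2 * D) (*-monoʳ-≤ (#A i) halving) ⟩
      2 * D * (#A i * (2 * #avoiding S))  ≡⟨ regroup D (#A i) (#avoiding S) ⟩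
      4 * D * #A i * #avoiding S          ≤⟨ *-monoˡ-≤ (#avoiding S) (A-rare i) ⟩
      t ^ m * #avoiding S                 ∎)
      where
      open ≤-Reasoning
      T : Fin n → Bool
      T = S ∖ Γ i
      T⊆S : T ⊆ S
      T⊆S = ∖-⊆ S (Γ i)
      halving : #avoiding T ≤ 2 * #avoiding S
      halving = #avoiding-halving T⊆S (≤-trans (size-mono (∖∖-⊆ S (Γ i))) (Γ-small i)) λ j j∈S∖T →
        #A-avoiding-bound k T (<-≤-trans (size-< T⊆S j j∈S∖T) (≤-pred |S|<1+k)) j
      regroup : ∀ D a f → 2 * D * (a * (2 * f)) ≡ 4 * D * a * f
      regroup = solve-∀

    #avoiding-positive : ∀ k S → size S < k → 0 < #avoiding S
    #avoiding-positive (suc k) S |S|<1+k with anyᵇ S in S-nonempty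
    ... | false = subst (0 <_) (sym all-avoiding) (m^n>0 t m)
      where
      all-avoiding : #avoiding S ≡ t ^ m
      all-avoiding = begin
        ∑ᶜ (𝟙 ∘ avoids S) ≡⟨ ∑ᶜ-cong (λ c → cong 𝟙 (allᵇ-intro _ λ w →
                               cong (λ b → not (b ∧ A w c)) (anyᵇ-false S S-nonempty w))) ⟩
        ∑ᶜ {m} (λ _ → 1)  ≡⟨ ∑ᶜ-const m 1 ⟩
        t ^ m * 1         ≡⟨ *-identityʳ (t ^ m) ⟩
        t ^ m             ∎
        where open ≡-Reasoning
    ... | true with anyᵇ-elim S S-nonempty
    ...   | j , Sj = *-cancelˡ-< 2 0 (#avoiding S) (<-≤-trans T-positive halving)
      where
      T : Fin n → Bool
      T = S ∖ single j
      T⊆S : T ⊆ S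
      T⊆S = ∖-⊆ S (single j)
      j∈S∖T : (S ∖ T) j ≡ true
      j∈S∖T rewrite Sj | dec-true (j ≟ᶠ j) refl = refl
      T-positive : 0 < #avoiding T
      T-positive = #avoiding-positive k T (<-≤-trans (size-< T⊆S j j∈S∖T) (≤-pred |S|<1+k))
      S∖T-small : size (S ∖ T) ≤ D
      S∖T-small = ≤-trans (size-mono (∖∖-⊆ S (single j))) (≤-trans (≤-reflexive (size-single j)) (>-nonZero⁻¹ D))
      halving : #avoiding T ≤ 2 * #avoiding S
      halving = #avoiding-halving T⊆S S∖T-small λ i _ → #A-avoiding-bound (suc (size T)) T ≤-refl i

    avoiding-colouring : ∃ λ c → ∀ i → A i c ≡ false
    avoiding-colouring = proj₁ witness , λ i → not-injective (allᵇ-elim (λ w → not (A w (proj₁ witness))) (𝟙>0⇒ (proj₂ witness)) i)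
      where
      everything : Fin n → Bool
      everything _ = true
      witness : ∃ λ c → 0 < 𝟙 (avoids everything c)
      witness = ∑ᶜ>0⇒ (𝟙 ∘ avoids everything) (#avoiding-positive _ everything ≤-refl)

-- The exponential series against the negative binomial series

expNum expDen : ℕ → ℕ → ℕ
expNum y zero    = 1
expNum y (suc j) = expNum y j * suc j ! + y ^ suc j * expDen y j
expDen y zero    = 1
expDen y (suc j) = expDen y j * suc j !

-- mkℚᵘ a d denotes a / (d + 1), so the summand y ^ (j + 1) / (j + 1)! is stored with d = pred ((j + 1)!).
expPartialᵘ : ℕ → ℕ → ℚᵘ
expPartialᵘ y zero    = ℚᵘ.1ℚᵘ
expPartialᵘ y (suc j) = expPartialᵘ y j ℚᵘ.+ mkℚᵘ (ℤ.+ (y ^ suc j)) (pred (suc j !))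

toℚᵘ-/≃mkℚᵘ : ∀ a {d} b → suc b ≡ d → .{{_ : NonZero d}} → ℚ.toℚᵘ (ℤ.+ a ℚ./ d) ℚᵘ.≃ mkℚᵘ (ℤ.+ a) b
toℚᵘ-/≃mkℚᵘ a b refl = ℚ.toℚᵘ-fromℚᵘ _

toℚᵘ-expPartial : ∀ y j → ℚ.toℚᵘ (expPartial y j) ℚᵘ.≃ expPartialᵘ y j
toℚᵘ-expPartial y zero    = ℚᵘ.≃-refl
toℚᵘ-expPartial y (suc j) = ℚᵘ.≃-trans (ℚ.toℚᵘ-homo-+ (expPartial y j) _)
  (ℚᵘ.+-cong (toℚᵘ-expPartial y j)
             (toℚᵘ-/≃mkℚᵘ (y ^ suc j) (pred (suc j !)) (suc-pred (suc j !) {{suc j !≢0}}) {{suc j !≢0}}))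

↥-+-mkℚᵘ : ∀ p a b → ↥ (p ℚᵘ.+ mkℚᵘ a b) ≡ ↥ p ℤ.* ℤ.+ suc b ℤ.+ a ℤ.* ↧ p
↥-+-mkℚᵘ (mkℚᵘ _ _) a b = refl

↧ₙ-+-mkℚᵘ : ∀ p a b → ↧ₙ (p ℚᵘ.+ mkℚᵘ a b) ≡ ↧ₙ p * suc b
↧ₙ-+-mkℚᵘ (mkℚᵘ _ _) a b = refl

↥-expPartialᵘ : ∀ y j → ↥ expPartialᵘ y j ≡ ℤ.+ expNum y j
↧-expPartialᵘ : ∀ y j → ↧ₙ expPartialᵘ y j ≡ expDen y j
↥-expPartialᵘ y zero    = refl
↥-expPartialᵘ y (suc j) = begin
  ↥ expPartialᵘ y (suc j)
    ≡⟨ ↥-+-mkℚᵘ p (ℤ.+ (y ^ suc j)) (pred (suc j !)) ⟩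
  ↥ p ℤ.* ℤ.+ suc (pred (suc j !)) ℤ.+ ℤ.+ (y ^ suc j) ℤ.* ↧ p
    ≡⟨ cong₂ (λ a b → a ℤ.* ℤ.+ suc (pred (suc j !)) ℤ.+ ℤ.+ (y ^ suc j) ℤ.* ℤ.+ b) (↥-expPartialᵘ y j) (↧-expPartialᵘ y j) ⟩
  ℤ.+ expNum y j ℤ.* ℤ.+ suc (pred (suc j !)) ℤ.+ ℤ.+ (y ^ suc j) ℤ.* ℤ.+ expDen y j
    ≡⟨ cong₂ ℤ._+_ (ℤ.pos-* (expNum y j) _) (ℤ.pos-* (y ^ suc j) _) ⟨
  ℤ.+ (expNum y j * suc (pred (suc j !)) + y ^ suc j * expDen y j)
    ≡⟨ cong (λ f → ℤ.+ (expNum y j * f + y ^ suc j * expDen y j)) (suc-pred (suc j !) {{suc j !≢0}}) ⟩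
  ℤ.+ expNum y (suc j) ∎
  where
  open ≡-Reasoning
  p = expPartialᵘ y j
↧-expPartialᵘ y zero    = refl
↧-expPartialᵘ y (suc j) = trans (↧ₙ-+-mkℚᵘ (expPartialᵘ y j) _ _) (cong₂ _*_ (↧-expPartialᵘ y j) (suc-pred (suc j !) {{suc j !≢0}}))

≤expPartial⇒ : ∀ N y j → (ℤ.+ N ℚ./ 1) ℚ.≤ expPartial y j → N * expDen y j ≤ expNum y j
≤expPartial⇒ N y j N≤e with ℚᵘ.≤-respˡ-≃ (toℚᵘ-/≃mkℚᵘ N 0 refl)
                              (ℚᵘ.≤-respʳ-≃ (toℚᵘ-expPartial y j) (ℚ.toℚᵘ-mono-≤ N≤e))
... | *≤* N*den≤num*1 = ℤ.drop‿+≤+ (subst₂ ℤ._≤_ lhs rhs N*den≤num*1)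
  where
  lhs : ℤ.+ N ℤ.* ↧ expPartialᵘ y j ≡ ℤ.+ (N * expDen y j)
  lhs = trans (cong (λ d → ℤ.+ N ℤ.* ℤ.+ d) (↧-expPartialᵘ y j)) (sym (ℤ.pos-* N _))
  rhs : ↥ expPartialᵘ y j ℤ.* ℤ.+ 1 ≡ ℤ.+ expNum y j
  rhs = trans (ℤ.*-identityʳ _) (↥-expPartialᵘ y j)

rising : ℕ → ℕ → ℕ
rising N zero    = 1
rising N (suc i) = rising N i * (N + i)

rising-suc : ∀ N i → rising N (suc i) ≡ N * rising (suc N) i
rising-suc N zero    = trans (*-identityˡ (N + 0)) (trans (+-identityʳ N) (sym (*-identityʳ N)))
rising-suc N (suc i) = begin
  rising N (suc i) * (N + suc i)     ≡⟨ cong₂ _*_ (rising-suc N i) (+-suc N i) ⟩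
  N * rising (suc N) i * (suc N + i) ≡⟨ *-assoc N _ _ ⟩
  N * rising (suc N) (suc i)         ∎
  where open ≡-Reasoning

^≤rising : ∀ N i → N ^ i ≤ rising N i
^≤rising N zero    = ≤-refl
^≤rising N (suc i) = begin
  N * N ^ i          ≡⟨ *-comm N (N ^ i) ⟩
  N ^ i * N          ≤⟨ *-mono-≤ (^≤rising N i) (m≤m+n N i) ⟩
  rising N i * (N + i) ∎
  where open ≤-Reasoning

-- C(N + i - 1, i), the number of multisets of size i drawn from N kinds.
multichoose : ℕ → ℕ → ℕ
multichoose zero    zero    = 1
multichoose zero    (suc i) = 0
multichoose (suc N) zero    = 1
multichoose (suc N) (suc i) = multichoose N (suc i) + multichoose (suc N) i

multichoose*!≡rising : ∀ N i → multichoose N i * i ! ≡ rising N i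
multichoose*!≡rising zero    zero    = refl
multichoose*!≡rising zero    (suc i) = sym (rising-suc 0 i)
multichoose*!≡rising (suc N) zero    = refl
multichoose*!≡rising (suc N) (suc i) = begin
  (a + b) * suc i !                                 ≡⟨ distrib a b (i !) i ⟩
  a * suc i ! + suc i * (b * i !)                   ≡⟨ cong₂ (λ x y → x + suc i * y) (multichoose*!≡rising N (suc i)) (multichoose*!≡rising (suc N) i) ⟩
  rising N (suc i) + suc i * rising (suc N) i       ≡⟨ cong (_+ suc i * rising (suc N) i) (rising-suc N i) ⟩
  N * rising (suc N) i + suc i * rising (suc N) i   ≡⟨ collect N i (rising (suc N) i) ⟩
  rising (suc N) i * (suc N + i)                    ∎
  where
  open ≡-Reasoning
  a = multichoose N (suc i)
  b = multichoose (suc N) i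
  distrib : ∀ a b f i → (a + b) * ((1 + i) * f) ≡ a * ((1 + i) * f) + (1 + i) * (b * f)
  distrib = solve-∀
  collect : ∀ N i r → N * r + (1 + i) * r ≡ r * (1 + N + i)
  collect = solve-∀

-- negBinomial M N j = Σ_{i ≤ j} multichoose N i · M ^ (j - i), a truncation of M ^ j · (1 - 1/M) ^ (-N).
negBinomial : ℕ → ℕ → ℕ → ℕ
negBinomial M N zero    = 1
negBinomial M N (suc j) = M * negBinomial M N j + multichoose N (suc j)

negBinomial-pascal : ∀ M N j → negBinomial M (suc N) (suc j) ≡ negBinomial M N (suc j) + negBinomial M (suc N) j
negBinomial-pascal M N zero    = regroup M (multichoose N 1)
  where
  regroup : ∀ M c → M * 1 + (c + 1) ≡ (M * 1 + c) + 1
  regroup = solve-∀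
negBinomial-pascal M N (suc j) = begin
  M * negBinomial M (suc N) (suc j) + (c + c′)
    ≡⟨ cong (λ x → M * x + (c + c′)) (negBinomial-pascal M N j) ⟩
  M * (negBinomial M N (suc j) + negBinomial M (suc N) j) + (c + c′)
    ≡⟨ regroup M (negBinomial M N (suc j)) (negBinomial M (suc N) j) c c′ ⟩
  (M * negBinomial M N (suc j) + c) + (M * negBinomial M (suc N) j + c′) ∎
  where
  open ≡-Reasoning
  c = multichoose N (suc (suc j))
  c′ = multichoose (suc N) (suc j)
  regroup : ∀ M a b x y → M * (a + b) + (x + y) ≡ (M * a + x) + (M * b + y)
  regroup = solve-∀

negBinomial-zero : ∀ M j → negBinomial M 0 j ≡ M ^ j
negBinomial-zero M zero    = refl
negBinomial-zero M (suc j) = trans (+-identityʳ _) (cong (M *_) (negBinomial-zero M j))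

-- Σ_{i ≤ j} multichoose N i · x ^ i ≤ (1 - x) ^ (-N) for x = 1/(u + 1), cleared of denominators.
^*negBinomial≤ : ∀ u N j → u ^ N * negBinomial (suc u) N j ≤ suc u ^ (N + j)
^*negBinomial≤ u zero j = ≤-reflexive (trans (+-identityʳ _) (negBinomial-zero (suc u) j))
^*negBinomial≤ u (suc N) zero = begin
  u ^ suc N * 1      ≡⟨ *-identityʳ _ ⟩
  u ^ suc N          ≤⟨ ^-monoˡ-≤ (suc N) (n≤1+n u) ⟩
  suc u ^ suc N      ≡⟨ cong (suc u ^_) (+-identityʳ (suc N)) ⟨
  suc u ^ (suc N + 0) ∎
  where open ≤-Reasoning
^*negBinomial≤ u (suc N) (suc j) = begin
  u ^ suc N * negBinomial (suc u) (suc N) (suc j)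
    ≡⟨ cong (u ^ suc N *_) (negBinomial-pascal (suc u) N j) ⟩
  u * u ^ N * (negBinomial (suc u) N (suc j) + negBinomial (suc u) (suc N) j)
    ≡⟨ distrib u (u ^ N) _ _ ⟩
  u * (u ^ N * negBinomial (suc u) N (suc j)) + u ^ suc N * negBinomial (suc u) (suc N) j
    ≤⟨ +-mono-≤ (*-monoʳ-≤ u (^*negBinomial≤ u N (suc j))) (^*negBinomial≤ u (suc N) j) ⟩
  u * suc u ^ (N + suc j) + suc u ^ (suc N + j)
    ≡⟨ cong (λ k → u * suc u ^ k + suc u ^ (suc N + j)) (+-suc N j) ⟩
  u * suc u ^ (suc N + j) + suc u ^ (suc N + j)
    ≡⟨ +-comm (u * suc u ^ (suc N + j)) _ ⟩
  suc u ^ suc (suc N + j)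
    ≡⟨ cong (suc u ^_) (+-suc (suc N) j) ⟨
  suc u ^ (suc N + suc j) ∎
  where
  open ≤-Reasoning
  distrib : ∀ u a x y → u * a * (x + y) ≡ u * (a * x) + u * a * y
  distrib = solve-∀

^-distrib-* : ∀ a b k → (a * b) ^ k ≡ a ^ k * b ^ k
^-distrib-* a b zero    = refl
^-distrib-* a b (suc k) = trans (cong (a * b *_) (^-distrib-* a b k)) (interchange a b (a ^ k) (b ^ k))

expDen-nonZero : ∀ y j → NonZero (expDen y j)
expDen-nonZero y zero    = _
expDen-nonZero y (suc j) = m*n≢0 (expDen y j) (suc j !) {{expDen-nonZero y j}} {{suc j !≢0}}

-- Termwise y ^ i / i! ≤ multichoose (M y) i / M ^ i, since (M y) ^ i ≤ rising (M y) i.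
expNum*^≤negBinomial*expDen : ∀ M y j → expNum y j * M ^ j ≤ negBinomial M (M * y) j * expDen y j
expNum*^≤negBinomial*expDen M y zero    = ≤-refl
expNum*^≤negBinomial*expDen M y (suc j) = begin
  (num * F + Y * den) * (M * M ^ j)                     ≡⟨ expand num F Y den M (M ^ j) ⟩
  M * (num * M ^ j) * F + (M * M ^ j * Y) * den
    ≤⟨ +-mono-≤ (*-monoˡ-≤ F (*-monoʳ-≤ M (expNum*^≤negBinomial*expDen M y j))) (*-monoˡ-≤ den term) ⟩
  M * (negBinomial M (M * y) j * den) * F + multichoose (M * y) (suc j) * F * den
    ≡⟨ collect M (negBinomial M (M * y) j) den F (multichoose (M * y) (suc j)) ⟩
  negBinomial M (M * y) (suc j) * (den * F)              ∎
  where
  open ≤-Reasoning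
  num = expNum y j
  den = expDen y j
  F = suc j !
  Y = y ^ suc j
  term : M ^ suc j * Y ≤ multichoose (M * y) (suc j) * F
  term = begin
    M ^ suc j * y ^ suc j          ≡⟨ ^-distrib-* M y (suc j) ⟨
    (M * y) ^ suc j                ≤⟨ ^≤rising (M * y) (suc j) ⟩
    rising (M * y) (suc j)         ≡⟨ multichoose*!≡rising (M * y) (suc j) ⟨
    multichoose (M * y) (suc j) * F ∎
  expand : ∀ n F Y d M p → (n * F + Y * d) * (M * p) ≡ M * (n * p) * F + (M * p * Y) * d
  expand = solve-∀
  collect : ∀ M s d F c → M * (s * d) * F + c * F * d ≡ (M * s + c) * (d * F)
  collect = solve-∀

≤exp⇒*^≤^ : ∀ X y → ≤exp X y → ∀ u → X * u ^ (suc u * y) ≤ suc u ^ (suc u * y)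
≤exp⇒*^≤^ X y (j , X≤e) u = *-cancelʳ-≤ _ _ (M ^ j) {{m^n≢0 M j}} (begin
  X * u ^ (M * y) * M ^ j          ≡⟨ xy∙z≈y∙xz X (u ^ (M * y)) (M ^ j) ⟩
  u ^ (M * y) * (X * M ^ j)        ≤⟨ *-monoʳ-≤ (u ^ (M * y)) X*M^j≤ ⟩
  u ^ (M * y) * negBinomial M (M * y) j ≤⟨ ^*negBinomial≤ u (M * y) j ⟩
  M ^ (M * y + j)                  ≡⟨ ^-distribˡ-+-* M (M * y) j ⟩
  M ^ (M * y) * M ^ j              ∎)
  where
  open ≤-Reasoning
  M = suc u
  X*M^j≤ : X * M ^ j ≤ negBinomial M (M * y) j
  X*M^j≤ = *-cancelʳ-≤ _ _ (expDen y j) {{expDen-nonZero y j}} (begin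
    X * M ^ j * expDen y j   ≡⟨ xy∙z≈y∙xz X (M ^ j) (expDen y j) ⟩
    M ^ j * (X * expDen y j) ≤⟨ *-monoʳ-≤ (M ^ j) (≤expPartial⇒ X y j X≤e) ⟩
    M ^ j * expNum y j       ≡⟨ *-comm (M ^ j) _ ⟩
    expNum y j * M ^ j       ≤⟨ expNum*^≤negBinomial*expDen M y j ⟩
    negBinomial M (M * y) j * expDen y j ∎)

^-cancelʳ-≤ : ∀ a b k → a ^ suc k ≤ b ^ suc k → a ≤ b
^-cancelʳ-≤ a b k aᵏ≤bᵏ = ≮⇒≥ (λ b<a → <⇒≱ (^-monoˡ-< (suc k) b<a) aᵏ≤bᵏ)

^-cancelˡ-≤ : ∀ a → 1 < a → ∀ {m n} → a ^ m ≤ a ^ n → m ≤ n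
^-cancelˡ-≤ a 1<a aᵐ≤aⁿ = ≮⇒≥ (λ n<m → <⇒≱ (^-monoʳ-< a 1<a n<m) aᵐ≤aⁿ)

bernoulli : ∀ a k → a ^ k * (a + k) ≤ suc a ^ k * a
bernoulli a zero    = ≤-reflexive (trans (+-identityʳ _) (trans (+-identityʳ a) (sym (+-identityʳ a))))
bernoulli a (suc k) = begin
  a * a ^ k * (a + suc k)                ≤⟨ m≤m+n _ (a ^ k * k) ⟩
  a * a ^ k * (a + suc k) + a ^ k * k    ≡⟨ regroup a (a ^ k) k ⟩
  suc a * (a ^ k * (a + k))              ≤⟨ *-monoʳ-≤ (suc a) (bernoulli a k) ⟩
  suc a * (suc a ^ k * a)                ≡⟨ *-assoc (suc a) (suc a ^ k) a ⟨
  suc a ^ suc k * a                      ∎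
  where
  open ≤-Reasoning
  regroup : ∀ a p k → a * p * (a + suc k) + p * k ≡ suc a * (p * (a + k))
  regroup = solve-∀

2*^≤suc^ : ∀ u → .{{NonZero u}} → 2 * u ^ suc u ≤ suc u ^ suc u
2*^≤suc^ u = *-cancelʳ-≤ _ _ u (begin
  2 * u ^ suc u * u         ≡⟨ regroup u (u ^ suc u) ⟩
  u ^ suc u * (u + u)       ≤⟨ *-monoʳ-≤ (u ^ suc u) (+-monoʳ-≤ u (n≤1+n u)) ⟩
  u ^ suc u * (u + suc u)   ≤⟨ bernoulli u (suc u) ⟩
  suc u ^ suc u * u         ∎)
  where
  open ≤-Reasoning
  regroup : ∀ u p → 2 * p * u ≡ p * (u + u)
  regroup = solve-∀

belowBound⇒t≤δ∸t : ∀ {R δ t} → .{{NonZero R}} → 2 ≤ t → BelowBound R δ t → t ≤ δ ∸ t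
belowBound⇒t≤δ∸t {R} {δ} {t} 2≤t (t≤δ , X≤e) = ^-cancelˡ-≤ 4 (s≤s (s≤s z≤n)) (begin
  4 ^ t                       ≤⟨ ^-monoˡ-≤ t 4≤Rδ² ⟩
  (R * (δ * δ)) ^ t           ≡⟨ trans (cong ((R * (δ * δ)) ^ t *_) (^-zeroˡ (2 * y))) (*-identityʳ ((R * (δ * δ)) ^ t)) ⟨
  (R * (δ * δ)) ^ t * 1 ^ (2 * y) ≤⟨ ≤exp⇒*^≤^ ((R * (δ * δ)) ^ t) y X≤e 1 ⟩
  2 ^ (2 * y)                 ≡⟨ ^-*-assoc 2 2 y ⟨
  4 ^ y                       ∎)
  where
  open ≤-Reasoning
  y = δ ∸ t
  2≤δ = ≤-trans 2≤t t≤δ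
  4≤Rδ² : 4 ≤ R * (δ * δ)
  4≤Rδ² = ≤-trans (*-mono-≤ 2≤δ 2≤δ) (m≤n*m (δ * δ) R)

belowBound⇒lllCondition : ∀ {R δ u} → .{{NonZero R}} → .{{NonZero u}} → BelowBound R δ (suc u) →
                          4 * (R * δ) * (suc u * u ^ δ) ≤ suc u ^ δ
belowBound⇒lllCondition {R} {δ} {u} bound@(t≤δ , X≤e) = *-cancelʳ-≤ _ _ δ {{δ≢0}} (begin
  4 * (R * δ) * (t * u ^ δ) * δ      ≡⟨ cong (λ p → 4 * (R * δ) * (t * p) * δ) (split u) ⟩
  4 * (R * δ) * (t * (u ^ t * u ^ y)) * δ ≡⟨ regroup R δ t (u ^ t) (u ^ y) ⟩
  (4 * t * u ^ t) * (R * (δ * δ) * u ^ y) ≤⟨ *-monoʳ-≤ (4 * t * u ^ t) Rδ²uʸ≤tʸ ⟩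
  (4 * t * u ^ t) * t ^ y            ≡⟨ halve t (u ^ t) (t ^ y) ⟩
  (2 * t) * (2 * u ^ t) * t ^ y      ≤⟨ *-monoˡ-≤ (t ^ y) (*-mono-≤ 2t≤δ (2*^≤suc^ u)) ⟩
  δ * t ^ t * t ^ y                  ≡⟨ xy∙z≈yz∙x δ (t ^ t) (t ^ y) ⟩
  (t ^ t * t ^ y) * δ                ≡⟨ cong (_* δ) (split t) ⟨
  t ^ δ * δ                          ∎)
  where
  open ≤-Reasoning
  t = suc u
  y = δ ∸ t
  t+y≡δ : t + y ≡ δ
  t+y≡δ = m+[n∸m]≡n t≤δ
  δ≢0 : NonZero δ
  δ≢0 = >-nonZero (≤-trans z<s t≤δ)
  split : ∀ a → a ^ δ ≡ a ^ t * a ^ y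
  split a = trans (cong (a ^_) (sym t+y≡δ)) (^-distribˡ-+-* a t y)
  2t≤δ : 2 * t ≤ δ
  2t≤δ = subst₂ _≤_ (cong (λ x → t + x) (sym (+-identityʳ t))) t+y≡δ
                    (+-monoʳ-≤ t (belowBound⇒t≤δ∸t (s≤s (>-nonZero⁻¹ u)) bound))
  ^[t*y] : ∀ a → a ^ (t * y) ≡ (a ^ y) ^ t
  ^[t*y] a = trans (cong (a ^_) (*-comm t y)) (sym (^-*-assoc a y t))
  Rδ²uʸ≤tʸ : R * (δ * δ) * u ^ y ≤ t ^ y
  Rδ²uʸ≤tʸ = ^-cancelʳ-≤ _ _ u (subst₂ _≤_
    (trans (cong ((R * (δ * δ)) ^ t *_) (^[t*y] u)) (sym (^-distrib-* (R * (δ * δ)) (u ^ y) t)))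
    (^[t*y] t)
    (≤exp⇒*^≤^ ((R * (δ * δ)) ^ t) y X≤e u))
  regroup : ∀ R δ t p q → 4 * (R * δ) * (t * (p * q)) * δ ≡ (4 * t * p) * (R * (δ * δ) * q)
  regroup = solve-∀
  halve : ∀ t p q → (4 * t * p) * q ≡ (2 * t) * (2 * p) * q
  halve = solve-∀

-- Colouring the hyperedges

length-filter-tabulate : ∀ {a ℓ} {A : Set a} {P : Pred A ℓ} (P? : Decidable P) {k} (f : Fin k → A) →
                         length (filter P? (tabulate f)) ≡ size (λ i → does (P? (f i)))
length-filter-tabulate P? {zero}  f = refl
length-filter-tabulate P? {suc k} f with does (P? (f zero))
... | true  = cong suc (length-filter-tabulate P? (f ∘ suc))
... | false = length-filter-tabulate P? (f ∘ suc)

does-∈? : ∀ {n} (v : Fin n) (p : Subset n) → does (v ∈? p) ≡ lookup p v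
does-∈? zero    (true  ∷ p) = refl
does-∈? zero    (false ∷ p) = refl
does-∈? (suc v) (_     ∷ p) = does-∈? v p

∣p∣≡size-lookup : ∀ {n} (p : Subset n) → ∣ p ∣ ≡ size (lookup p)
∣p∣≡size-lookup []          = refl
∣p∣≡size-lookup (true  ∷ p) = cong suc (∣p∣≡size-lookup p)
∣p∣≡size-lookup (false ∷ p) = ∣p∣≡size-lookup p

incident : (H : Hypergraph) → Fin (n H) → Fin (m H) → Bool
incident H v e = lookup (edge H e) v

degree≡size-incident : ∀ H v → degree H v ≡ size (incident H v)
degree≡size-incident H v = trans (length-filter-tabulate (λ e → v ∈? edge H e) (λ e → e))
                                 (sum-cong (λ e → cong 𝟙 (does-∈? v (edge H e))))

keepFirst : ℕ → ∀ {k} → (Fin k → Bool) → Fin k → Bool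
keepFirst zero    p e       = false
keepFirst (suc r) p zero    = p zero
keepFirst (suc r) p (suc e) = if p zero then keepFirst r (p ∘ suc) e else keepFirst (suc r) (p ∘ suc) e

keepFirst-⊆ : ∀ r {k} (p : Fin k → Bool) → keepFirst r p ⊆ p
keepFirst-⊆ (suc r) p zero    kept = kept
keepFirst-⊆ (suc r) p (suc e) kept with p zero
... | true  = keepFirst-⊆ r (p ∘ suc) e kept
... | false = keepFirst-⊆ (suc r) (p ∘ suc) e kept

size-keepFirst : ∀ r {k} (p : Fin k → Bool) → r ≤ size p → size (keepFirst r p) ≡ r
size-keepFirst zero    {k}     p _    = trans (sum-const k 0) (*-zeroʳ k)
size-keepFirst (suc r) {suc k} p r≤|p| with p zero
... | true  = cong suc (size-keepFirst r (p ∘ suc) (≤-pred r≤|p|))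
... | false = size-keepFirst (suc r) (p ∘ suc) r≤|p|

not∨not-does≡false⇒ : ∀ l {A : Set} {x y : A} (x≟y : Dec (x ≡ y)) → (not l ∨ not (does x≟y)) ≡ false → l ≡ true × x ≡ y
not∨not-does≡false⇒ true (yes x≡y) _ = refl , x≡y

module CoverColouring (H : Hypergraph) {R δ u : ℕ} .{{_ : NonZero R}} .{{_ : NonZero δ}} .{{_ : NonZero u}}
  (edge≤R : ∀ e → ∣ edge H e ∣ ≤ R) (δ≤degree : ∀ v → δ ≤ degree H v) (bound : BelowBound R δ (suc u)) where

  t : ℕ
  t = suc u

  open Colourings t

  L : Fin (n H) → Fin (m H) → Bool
  L v = keepFirst δ (incident H v)

  size-L : ∀ v → size (L v) ≡ δ
  size-L v = size-keepFirst δ (incident H v) (subst (δ ≤_) (degree≡size-incident H v) (δ≤degree v))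

  misses : Fin (n H) → Fin t → Colouring (m H) → Bool
  misses v a c = allᵇ (λ e → not (L v e) ∨ not (does (c e ≟ᶠ a)))

  bad : Fin (n H) → Colouring (m H) → Bool
  bad v c = anyᵇ (λ a → misses v a c)

  Γ : Fin (n H) → Fin (n H) → Bool
  Γ v w = anyᵇ (λ e → L v e ∧ L w e)

  open LocalLemma bad Γ (R * δ) {{m*n≢0 R δ}}

  bad-local : ∀ v c c′ → (∀ e → L v e ≡ true → c e ≡ c′ e) → bad v c ≡ bad v c′
  bad-local v c c′ agree = anyᵇ-cong λ a → allᵇ-cong λ e → local a e
    where
    local : ∀ a e → (not (L v e) ∨ not (does (c e ≟ᶠ a))) ≡ (not (L v e) ∨ not (does (c′ e ≟ᶠ a)))
    local a e with L v e in Lve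
    ... | true  rewrite agree e Lve = refl
    ... | false = refl

  Γ≡false⇒disjoint : ∀ {v w} → Γ v w ≡ false → ∀ e → L w e ≡ true → not (L v e) ≡ true
  Γ≡false⇒disjoint {v} {w} Γvw≡false e Lwe = cong not (∧≡false⇒ Lwe (anyᵇ-false _ Γvw≡false e))

  bad-independent : ∀ v S → t ^ m H * #A-avoiding v (S ∖ Γ v) ≤ #A v * #avoiding (S ∖ Γ v)
  bad-independent v S = ≤-reflexive (trans (cong (t ^ m H *_) (∑ᶜ-cong λ c → 𝟙-∧ (bad v c) _))
    (∑ᶜ-independent (L v) (λ c c′ agree → cong 𝟙 (bad-local v c c′ agree)) avoiding-local))
    where
    avoiding-local : DependsOn (not ∘ L v) (𝟙 ∘ avoids (S ∖ Γ v))
    avoiding-local c c′ agree = cong 𝟙 (allᵇ-cong pointwise)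
      where
      pointwise : ∀ w → not ((S ∖ Γ v) w ∧ bad w c) ≡ not ((S ∖ Γ v) w ∧ bad w c′)
      pointwise w with (S ∖ Γ v) w in w∈
      ... | false = refl
      ... | true  = cong not (bad-local w c c′ λ e Lwe →
                      agree e (Γ≡false⇒disjoint (proj₂ (∖-true⇒ {S = S} {Γ v} w w∈)) e Lwe))

  Γ-small : ∀ v → size (Γ v) ≤ R * δ
  Γ-small v = begin
    ∑[ w < n H ] 𝟙 (Γ v w)
      ≤⟨ sum-mono-≤ (λ w → 𝟙-anyᵇ (λ e → L v e ∧ L w e)) ⟩
    ∑[ w < n H ] ∑[ e < m H ] 𝟙 (L v e ∧ L w e)
      ≤⟨ sum-mono-≤ (λ w → sum-mono-≤ (λ e → 𝟙-∧-monoʳ (L v e) (keepFirst-⊆ δ (incident H w) e))) ⟩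
    ∑[ w < n H ] ∑[ e < m H ] 𝟙 (L v e ∧ incident H w e)
      ≡⟨ ∑-comm (λ w e → 𝟙 (L v e ∧ incident H w e)) ⟩
    ∑[ e < m H ] ∑[ w < n H ] 𝟙 (L v e ∧ incident H w e)
      ≡⟨ sum-cong (λ e → trans (sum-cong (λ w → 𝟙-∧ (L v e) (incident H w e))) (sym (*-distribˡ-sum (𝟙 (L v e)) (λ w → 𝟙 (incident H w e))))) ⟩
    ∑[ e < m H ] (𝟙 (L v e) * size (lookup (edge H e)))
      ≡⟨ sum-cong (λ e → cong (𝟙 (L v e) *_) (∣p∣≡size-lookup (edge H e))) ⟨
    ∑[ e < m H ] (𝟙 (L v e) * ∣ edge H e ∣)
      ≤⟨ sum-mono-≤ (λ e → *-monoʳ-≤ (𝟙 (L v e)) (edge≤R e)) ⟩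
    ∑[ e < m H ] (𝟙 (L v e) * R)
      ≡⟨ *-distribʳ-sum R (𝟙 ∘ L v) ⟨
    size (L v) * R
      ≡⟨ trans (cong (_* R) (size-L v)) (*-comm δ R) ⟩
    R * δ ∎
    where open ≤-Reasoning

  choices : Bool → ℕ
  choices true  = u
  choices false = t

  sum-avoiding-colour : ∀ l (a : Fin t) → ∑[ b < t ] 𝟙 (not l ∨ not (does (b ≟ᶠ a))) ≡ choices l
  sum-avoiding-colour true  a = size-∁-single a
  sum-avoiding-colour false a = trans (sum-const t 1) (*-identityʳ t)

  prod-choices : ∀ {k} (l : Fin k → Bool) → prod (choices ∘ l) * t ^ size l ≡ u ^ size l * t ^ k
  prod-choices {zero}  l = refl
  prod-choices {suc k} l with l zero | prod-choices (l ∘ suc)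
  ... | true  | ih = trans (shuffle u (prod (choices ∘ l ∘ suc)) t _)
                      (trans (cong (λ x → u * x * t) ih) (shuffle′ u (u ^ size (l ∘ suc)) (t ^ k) t))
    where
    shuffle : ∀ u P t q → u * P * (t * q) ≡ u * (P * q) * t
    shuffle = solve-∀
    shuffle′ : ∀ u a b t → u * (a * b) * t ≡ u * a * (t * b)
    shuffle′ = solve-∀
  ... | false | ih = trans (*-assoc t (prod (choices ∘ l ∘ suc)) _)
                      (trans (cong (t *_) ih) (x∙yz≈y∙xz t (u ^ size (l ∘ suc)) (t ^ k)))

  #misses : ∀ v a → ∑ᶜ (𝟙 ∘ misses v a) * t ^ δ ≡ u ^ δ * t ^ m H
  #misses v a = begin
    ∑ᶜ (𝟙 ∘ misses v a) * t ^ δ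
      ≡⟨ cong (_* t ^ δ) (∑ᶜ-cong (λ c → 𝟙-allᵇ (λ e → not (L v e) ∨ not (does (c e ≟ᶠ a))))) ⟩
    ∑ᶜ (λ c → prod (λ e → 𝟙 (not (L v e) ∨ not (does (c e ≟ᶠ a))))) * t ^ δ
      ≡⟨ cong (_* t ^ δ) (∑ᶜ-prod (λ e b → 𝟙 (not (L v e) ∨ not (does (b ≟ᶠ a))))) ⟩
    prod (λ e → ∑[ b < t ] 𝟙 (not (L v e) ∨ not (does (b ≟ᶠ a)))) * t ^ δ
      ≡⟨ cong (_* t ^ δ) (prod-cong (λ e → sum-avoiding-colour (L v e) a)) ⟩
    prod (choices ∘ L v) * t ^ δ
      ≡⟨ subst (λ k → prod (choices ∘ L v) * t ^ k ≡ u ^ k * t ^ m H) (size-L v) (prod-choices (L v)) ⟩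
    u ^ δ * t ^ m H ∎
    where open ≡-Reasoning

  #A*t^δ≤ : ∀ v → #A v * t ^ δ ≤ t * (u ^ δ * t ^ m H)
  #A*t^δ≤ v = begin
    #A v * t ^ δ
      ≤⟨ *-monoˡ-≤ (t ^ δ) (∑ᶜ-mono-≤ (λ c → 𝟙-anyᵇ (λ a → misses v a c))) ⟩
    ∑ᶜ (λ c → ∑[ a < t ] 𝟙 (misses v a c)) * t ^ δ
      ≡⟨ cong (_* t ^ δ) (∑ᶜ-comm-sum (λ a c → 𝟙 (misses v a c))) ⟩
    ∑[ a < t ] ∑ᶜ (𝟙 ∘ misses v a) * t ^ δ
      ≡⟨ *-distribʳ-sum (t ^ δ) (λ a → ∑ᶜ (𝟙 ∘ misses v a)) ⟩
    ∑[ a < t ] (∑ᶜ (𝟙 ∘ misses v a) * t ^ δ)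
      ≡⟨ sum-cong (#misses v) ⟩
    ∑[ a < t ] (u ^ δ * t ^ m H)
      ≡⟨ sum-const t (u ^ δ * t ^ m H) ⟩
    t * (u ^ δ * t ^ m H) ∎
    where open ≤-Reasoning

  bad-rare : ∀ v → 4 * (R * δ) * #A v ≤ t ^ m H
  bad-rare v = *-cancelˡ-≤ (t ^ δ) {{m^n≢0 t δ}} (begin
    t ^ δ * (4 * (R * δ) * #A v)          ≡⟨ x∙yz≈y∙zx (t ^ δ) (4 * (R * δ)) (#A v) ⟩
    4 * (R * δ) * (#A v * t ^ δ)          ≤⟨ *-monoʳ-≤ (4 * (R * δ)) (#A*t^δ≤ v) ⟩
    4 * (R * δ) * (t * (u ^ δ * t ^ m H)) ≡⟨ reassoc (4 * (R * δ)) t (u ^ δ) (t ^ m H) ⟩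
    4 * (R * δ) * (t * u ^ δ) * t ^ m H   ≤⟨ *-monoˡ-≤ (t ^ m H) (belowBound⇒lllCondition bound) ⟩
    t ^ δ * t ^ m H                       ∎)
    where
    open ≤-Reasoning
    reassoc : ∀ d t a b → d * (t * (a * b)) ≡ d * (t * a) * b
    reassoc = solve-∀

  bad-free⇒covers : ∀ c → (∀ v → bad v c ≡ false) → PartitionIntoCovers H t
  bad-free⇒covers c bad-free = c , covered
    where
    covered : ∀ i v → ∃ λ e → c e ≡ i × v ∈ edge H e
    covered i v with allᵇ-false (λ e → not (L v e) ∨ not (does (c e ≟ᶠ i))) (anyᵇ-false (λ a → misses v a c) (bad-free v) i)
    ... | e , e-unmissed with not∨not-does≡false⇒ (L v e) (c e ≟ᶠ i) e-unmissed
    ...   | Lve , cₑ≡i = e , cₑ≡i , lookup⇒[]= v (edge H e) (keepFirst-⊆ δ (incident H v) e Lve)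

  partition : PartitionIntoCovers H t
  partition = bad-free⇒covers (proj₁ colouring) (proj₂ colouring)
    where
    colouring : ∃ λ c → ∀ v → bad v c ≡ false
    colouring = avoiding-colouring bad-independent Γ-small bad-rare

one-cover : (H : Hypergraph) → (∀ v → 1 ≤ degree H v) → PartitionIntoCovers H 1
one-cover H 1≤degree = (λ _ → zero) , covered
  where
  covered : ∀ i v → ∃ λ e → zero ≡ i × v ∈ edge H e
  covered zero v with sum>0⇒term>0 (𝟙 ∘ incident H v) (subst (1 ≤_) (degree≡size-incident H v) (1≤degree v))
  ... | e , v∈e = e , refl , lookup⇒[]= v (edge H e) (𝟙>0⇒ v∈e)

proposition1 : (R δ : ℕ) → 1 ≤ R → 1 ≤ δ → (H : Hypergraph) → ((e : Fin (m H)) → ∣ edge H e ∣ ≤ R) → ((v : Fin (n H)) → δ ≤ degree H v) → (t : ℕ) → BelowBound R δ t → p′-atLeast H t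
proposition1 R δ 1≤R 1≤δ H edge≤R δ≤degree zero          _     = 1 , z≤n , one-cover H (λ v → ≤-trans 1≤δ (δ≤degree v))
proposition1 R δ 1≤R 1≤δ H edge≤R δ≤degree (suc zero)    _     = 1 , ≤-refl , one-cover H (λ v → ≤-trans 1≤δ (δ≤degree v))
proposition1 R δ 1≤R 1≤δ H edge≤R δ≤degree (suc (suc u)) bound = suc (suc u) , ≤-refl ,
  CoverColouring.partition H {{>-nonZero 1≤R}} {{>-nonZero 1≤δ}} edge≤R δ≤degree bound
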